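{- Let $\Gamma=(V,E)$ be a connected graph of valency at least $3$, $G\leqslant\mathrm{Aut}(\Gamma)$ with $\Gamma$ $(G,2)$-arc-transitive, $\{\alpha_1,\alpha_2\}\in E$, $G^*=\langle G_{\alpha_1},G_{\alpha_2}\rangle$ and $M=\mathrm{soc}(G^*)$. Assume $G^*$ is quasiprimitive of PA type on each of its orbits on $V$, i.e. $M=T_1\times\cdots\times T_n$ is the unique minimal normal subgroup of $G^*$ with $n\geqslant 2$ and $T_i$ pairwise isomorphic nonabelian simple groups, and for each $\alpha\in V$ there are subgroups $R_i<T_i$ with $M_\alpha\leqslant R_1\times\cdots\times R_n$ such that each projection $M_\alpha\to R_i$ is surjective. For $1\leqslant i\leqslant n$ let $N_i=\prod_{j\neq i}T_j$. Then every $N_i$ is intransitive on each of the $M$-orbits on $V$.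
   Context: Graphs are finite, simple, undirected; $(G,2)$-arc-transitive means $G$ transitive on $2$-arcs. Quasiprimitive: every minimal normal subgroup is transitive. -}

module Defs where

open import Level using (0ℓ)
open import Data.Nat using (ℕ; zero; suc; _≥_)
open import Data.Fin using (Fin)
import Data.Fin as F
open import Data.Vec using (Vec; lookup; tabulate)
open import Data.Product using (Σ; ∃; ∃-syntax; _×_; _,_)
open import Data.Sum using (_⊎_)
open import Relation.Unary using (Pred)
open import Relation.Nullary using (¬_)
open import Relation.Binary.PropositionalEquality using (_≡_)
open import Relation.Binary.Construct.Closure.ReflexiveTransitive using (Star)

-- Permutations of the vertex set Fin v, represented as vectors
-- (position x holds the image of x), so equality is propositional.

Perm : ℕ → Set
Perm v = Vec (Fin v) v

_·_ : ∀ {v} → Perm v → Fin v → Fin v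
σ · x = lookup σ x

idP : ∀ {v} → Perm v
idP = tabulate (λ x → x)

_∘ₚ_ : ∀ {v} → Perm v → Perm v → Perm v
σ ∘ₚ τ = tabulate (λ x → σ · (τ · x))

IsPerm : ∀ {v} → Perm v → Set
IsPerm σ = ∀ x y → σ · x ≡ σ · y → x ≡ y

Grp : ℕ → Set₁
Grp v = Pred (Perm v) 0ℓ

record IsSubgroup {v} (H : Grp v) : Set where
  field
    perm  : ∀ g → H g → IsPerm g
    hasId : H idP
    comp  : ∀ g h → H g → H h → H (g ∘ₚ h)
    inv   : ∀ g → H g → ∃[ h ] (H h × g ∘ₚ h ≡ idP)

_⊆G_ : ∀ {v} → Grp v → Grp v → Set
H ⊆G K = ∀ g → H g → K g

_≐G_ : ∀ {v} → Grp v → Grp v → Set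
H ≐G K = (H ⊆G K) × (K ⊆G H)

Trivial : ∀ {v} → Grp v → Set
Trivial H = ∀ g → H g → g ≡ idP

-- H is a normal subgroup of K  (kHk⁻¹ ⊆ H, written as kH ⊆ Hk)
IsNormalIn : ∀ {v} → Grp v → Grp v → Set
IsNormalIn H K = IsSubgroup H × H ⊆G K ×
  (∀ k h → K k → H h → ∃[ h' ] (H h' × k ∘ₚ h ≡ h' ∘ₚ k))

IsMinimalNormal : ∀ {v} → Grp v → Grp v → Set₁
IsMinimalNormal N K = IsNormalIn N K × ¬ Trivial N ×
  (∀ (L : Grp _) → IsNormalIn L K → L ⊆G N → Trivial L ⊎ (L ≐G N))

IsNonabelianSimple : ∀ {v} → Grp v → Set₁
IsNonabelianSimple T = IsSubgroup T × ¬ Trivial T ×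
  (∃[ a ] ∃[ b ] (T a × T b × ¬ (a ∘ₚ b ≡ b ∘ₚ a))) ×
  (∀ (L : Grp _) → IsNormalIn L T → Trivial L ⊎ (L ≐G T))

Isomorphic : ∀ {v} → Grp v → Grp v → Set
Isomorphic H K = Σ (Perm _ → Perm _) λ f →
  (∀ g → H g → K (f g)) ×
  (∀ g h → H g → H h → f g ≡ f h → g ≡ h) ×
  (∀ k → K k → ∃[ g ] (H g × f g ≡ k)) ×
  (∀ g h → H g → H h → f (g ∘ₚ h) ≡ f g ∘ₚ f h)

data Gen {v} (S : Grp v) : Grp v where
  gen  : ∀ {g} → S g → Gen S g
  gid  : Gen S idP
  gcmp : ∀ {g h} → Gen S g → Gen S h → Gen S (g ∘ₚ h)
  ginv : ∀ {g} h → Gen S g → g ∘ₚ h ≡ idP → Gen S h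

_∪G_ : ∀ {v} → Grp v → Grp v → Grp v
(H ∪G K) g = H g ⊎ K g

Stab : ∀ {v} → Grp v → Fin v → Grp v
Stab G α g = G g × g · α ≡ α

prod : ∀ {v n} → (Fin n → Perm v) → Perm v
prod {n = zero}  t = idP
prod {n = suc n} t = t F.zero ∘ₚ prod (λ i → t (F.suc i))

InFactors : ∀ {v n} → (Fin n → Grp v) → (Fin n → Perm v) → Set
InFactors T t = ∀ i → T i (t i)

IsDirectProduct : ∀ {v n} → Grp v → (Fin n → Grp v) → Set
IsDirectProduct M T =
  IsSubgroup M ×
  (∀ i → IsSubgroup (T i)) ×
  (∀ i → T i ⊆G M) ×
  (∀ i j → ¬ i ≡ j → ∀ a b → T i a → T j b → a ∘ₚ b ≡ b ∘ₚ a) ×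
  (∀ m → M m → ∃[ t ] (InFactors T t × m ≡ prod t)) ×
  (∀ t s → InFactors T t → InFactors T s → prod t ≡ prod s → ∀ i → t i ≡ s i)

IsComponent : ∀ {v n} → (Fin n → Grp v) → Perm v → Fin n → Perm v → Set
IsComponent T m i x = ∃[ t ] (InFactors T t × m ≡ prod t × t i ≡ x)

Ncomp : ∀ {v n} → (Fin n → Grp v) → Fin n → Grp v
Ncomp T i g = ∃[ t ] (InFactors T t × t i ≡ idP × g ≡ prod t)

record Graph (v : ℕ) : Set₁ where
  field
    Adj    : Fin v → Fin v → Set
    sym    : ∀ {x y} → Adj x y → Adj y x
    irrefl : ∀ {x} → ¬ Adj x x
open Graph public

Connected : ∀ {v} → Graph v → Set
Connected Γ = ∀ x y → Star (Adj Γ) x y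

ValencyAtLeast3 : ∀ {v} → Graph v → Set
ValencyAtLeast3 Γ = ∀ x → ∃[ a ] ∃[ b ] ∃[ c ]
  (Adj Γ x a × Adj Γ x b × Adj Γ x c × ¬ a ≡ b × ¬ a ≡ c × ¬ b ≡ c)

IsAut : ∀ {v} → Graph v → Perm v → Set
IsAut Γ σ = IsPerm σ ×
  (∀ x y → (Adj Γ x y → Adj Γ (σ · x) (σ · y)) × (Adj Γ (σ · x) (σ · y) → Adj Γ x y))

IsAutGroup : ∀ {v} → Graph v → Grp v → Set
IsAutGroup Γ G = IsSubgroup G × (∀ g → G g → IsAut Γ g)

Is2Arc : ∀ {v} → Graph v → Fin v → Fin v → Fin v → Set
Is2Arc Γ a b c = Adj Γ a b × Adj Γ b c × ¬ a ≡ c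

Is2ArcTransitive : ∀ {v} → Graph v → Grp v → Set
Is2ArcTransitive Γ G = ∀ a b c a' b' c' → Is2Arc Γ a b c → Is2Arc Γ a' b' c' →
  ∃[ g ] (G g × g · a ≡ a' × g · b ≡ b' × g · c ≡ c')

IsPAType : ∀ {v n} → Grp v → Grp v → (Fin n → Grp v) → Set₁
IsPAType {v} {n} Gs M T =
  IsMinimalNormal M Gs ×
  (∀ (L : Grp v) → IsMinimalNormal L Gs → L ≐G M) ×
  n ≥ 2 ×
  IsDirectProduct M T ×
  (∀ i → IsNonabelianSimple (T i)) ×
  (∀ i j → Isomorphic (T i) (T j)) ×
  -- quasiprimitive: M (the only minimal normal subgroup) transitive on each G*-orbit
  (∀ α g → Gs g → ∃[ m ] (M m × m · α ≡ g · α)) ×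
  (∀ α → Σ (Fin n → Grp v) λ R →
      (∀ i → IsSubgroup (R i) × R i ⊆G T i × ∃[ g ] (T i g × ¬ R i g)) ×
      (∀ m → Stab M α m → ∀ i x → IsComponent T m i x → R i x) ×
      (∀ i r → R i r → ∃[ m ] (Stab M α m × IsComponent T m i r)))

{-# OPTIONS --safe #-}
-- Pick g ∈ T_i ∖ R_i. If some h ∈ N_i mapped α to g⁻¹α, then gh
-- would lie in M_α, and since h has trivial i-th coordinate, the i-th
-- coordinate of gh is g ∉ R_i, contradicting M_α ≤ R_1 × ⋯ × R_n.  Hence the
-- M-orbit point g⁻¹α is not in the N_i-orbit of α.
module Submission where

open import Defs hiding (sym)
open import Data.Nat using (ℕ; zero; suc)
open import Data.Fin using (Fin; zero; suc; _≟_)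
open import Data.Fin.Properties using (suc-injective)
open import Data.Vec.Functional using (updateAt)
open import Data.Vec.Functional.Properties using (updateAt-updates; updateAt-minimal)
open import Data.Vec.Properties using (lookup∘tabulate; tabulate∘lookup; tabulate-cong)
open import Function using (_∘_)
open import Data.Product using (∃-syntax; _×_; _,_)
open import Relation.Nullary using (¬_; yes; no)
open import Relation.Binary.PropositionalEquality
open ≡-Reasoning

module _ {v : ℕ} where

  ·-∘ₚ : (σ τ : Perm v) (x : Fin v) → (σ ∘ₚ τ) · x ≡ σ · (τ · x)
  ·-∘ₚ σ τ x = lookup∘tabulate _ x

  ·-idP : (x : Fin v) → idP · x ≡ x
  ·-idP x = lookup∘tabulate _ x

  ∘ₚ-assoc : (a b c : Perm v) → (a ∘ₚ b) ∘ₚ c ≡ a ∘ₚ (b ∘ₚ c)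
  ∘ₚ-assoc a b c = tabulate-cong λ x →
    trans (·-∘ₚ a b (c · x)) (cong (a ·_) (sym (·-∘ₚ b c x)))

  ∘ₚ-identityʳ : (a : Perm v) → a ∘ₚ idP ≡ a
  ∘ₚ-identityʳ a =
    trans (tabulate-cong λ x → cong (a ·_) (·-idP x)) (tabulate∘lookup a)

  PairwiseCommuting : ∀ {n} → (Fin n → Grp v) → Set
  PairwiseCommuting T = ∀ i j → ¬ i ≡ j → ∀ a b → T i a → T j b → a ∘ₚ b ≡ b ∘ₚ a

  prod-closed : ∀ (M : Grp v) → IsSubgroup M → ∀ {n} (T : Fin n → Grp v) →
                (∀ i → T i ⊆G M) → ∀ t → InFactors T t → M (prod t)
  prod-closed M sM {zero}  T T⊆M t ft = IsSubgroup.hasId sM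
  prod-closed M sM {suc n} T T⊆M t ft =
    IsSubgroup.comp sM _ _ (T⊆M zero _ (ft zero))
      (prod-closed M sM (T ∘ suc) (T⊆M ∘ suc) (t ∘ suc) (ft ∘ suc))

  InFactors-updateAt : ∀ {n} (T : Fin n → Grp v) t → InFactors T t →
                       ∀ i f → T i (f (t i)) → InFactors T (updateAt t i f)
  InFactors-updateAt T t ft i f Tf j with j ≟ i
  ... | yes refl = subst (T j) (sym (updateAt-updates j t)) Tf
  ... | no j≢i   = subst (T j) (sym (updateAt-minimal j i t j≢i)) (ft j)

  -- Left multiplication by g ∈ T i only changes the i-th coordinate, because
  -- g commutes past the factors in front of it.
  ∘ₚ-prod : ∀ {n} (T : Fin n → Grp v) → PairwiseCommuting T →
            ∀ t → InFactors T t → ∀ i g → T i g →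
            g ∘ₚ prod t ≡ prod (updateAt t i (g ∘ₚ_))
  ∘ₚ-prod T comm t ft zero g Tg = sym (∘ₚ-assoc g (t zero) (prod (t ∘ suc)))
  ∘ₚ-prod T comm t ft (suc i) g Tg = begin
    g ∘ₚ (t zero ∘ₚ P)   ≡⟨ sym (∘ₚ-assoc g (t zero) P) ⟩
    (g ∘ₚ t zero) ∘ₚ P   ≡⟨ cong (_∘ₚ P) (comm (suc i) zero (λ ()) g (t zero) Tg (ft zero)) ⟩
    (t zero ∘ₚ g) ∘ₚ P   ≡⟨ ∘ₚ-assoc (t zero) g P ⟩
    t zero ∘ₚ (g ∘ₚ P)   ≡⟨ cong (t zero ∘ₚ_) (∘ₚ-prod (T ∘ suc)
                              (λ a b a≢b → comm (suc a) (suc b) (a≢b ∘ suc-injective))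
                              (t ∘ suc) (ft ∘ suc) i g Tg) ⟩
    t zero ∘ₚ prod (updateAt (t ∘ suc) i (g ∘ₚ_)) ∎
    where P = prod (t ∘ suc)

  IsComponent-∘ₚ-Ncomp : ∀ {n} (M : Grp v) (T : Fin n → Grp v) → IsDirectProduct M T →
                         ∀ i g h → T i g → Ncomp T i h → IsComponent T (g ∘ₚ h) i g
  IsComponent-∘ₚ-Ncomp M T (_ , sT , _ , comm , _ , _) i g h Tg (t , ft , tᵢ≡id , refl) =
    updateAt t i (g ∘ₚ_) ,
    InFactors-updateAt T t ft i (g ∘ₚ_) (IsSubgroup.comp (sT i) _ _ Tg (ft i)) ,
    ∘ₚ-prod T comm t ft i g Tg ,
    (begin
      updateAt t i (g ∘ₚ_) i ≡⟨ updateAt-updates i t ⟩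
      g ∘ₚ t i               ≡⟨ cong (g ∘ₚ_) tᵢ≡id ⟩
      g ∘ₚ idP               ≡⟨ ∘ₚ-identityʳ g ⟩
      g                      ∎)

  Ncomp-orbit-avoids : ∀ {n} (M : Grp v) (T : Fin n → Grp v) → IsDirectProduct M T →
    ∀ i α (R : Grp v) → (∀ m → Stab M α m → ∀ x → IsComponent T m i x → R x) →
    ∀ g g⁻¹ → T i g → ¬ R g → g ∘ₚ g⁻¹ ≡ idP →
    ∀ h → Ncomp T i h → ¬ h · α ≡ g⁻¹ · α
  Ncomp-orbit-avoids M T dp@(sM , _ , T⊆M , _) i α R M-α⊆R g g⁻¹ Tg ¬Rg gg⁻¹≡id
    h Nh@(t , ft , _ , refl) hα≡g⁻¹α =
    ¬Rg (M-α⊆R (g ∘ₚ h) (gh∈M , gh-fixes-α) g (IsComponent-∘ₚ-Ncomp M T dp i g h Tg Nh))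
    where
    gh∈M : M (g ∘ₚ h)
    gh∈M = IsSubgroup.comp sM _ _ (T⊆M i g Tg) (prod-closed M sM T T⊆M t ft)

    gh-fixes-α : (g ∘ₚ h) · α ≡ α
    gh-fixes-α = begin
      (g ∘ₚ h) · α     ≡⟨ ·-∘ₚ g h α ⟩
      g · (h · α)      ≡⟨ cong (g ·_) hα≡g⁻¹α ⟩
      g · (g⁻¹ · α)    ≡⟨ sym (·-∘ₚ g g⁻¹ α) ⟩
      (g ∘ₚ g⁻¹) · α   ≡⟨ cong (_· α) gg⁻¹≡id ⟩
      idP · α          ≡⟨ ·-idP α ⟩
      α                ∎

lemma4p1 : ∀ {v : ℕ} (Γ : Graph v) (G : Grp v) (α₁ α₂ : Fin v) {n : ℕ}
    (M : Grp v) (T : Fin n → Grp v) →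
    Connected Γ → ValencyAtLeast3 Γ →
    IsAutGroup Γ G → Is2ArcTransitive Γ G →
    Adj Γ α₁ α₂ →
    IsPAType (Gen (Stab G α₁ ∪G Stab G α₂)) M T →
    ∀ (i : Fin n) (α : Fin v) →
    ∃[ m ] (M m × (∀ h → Ncomp T i h → ¬ (h · α ≡ m · α)))
lemma4p1 Γ G α₁ α₂ M T _ _ _ _ _ (_ , _ , _ , dp@(_ , sT , T⊆M , _) , _ , _ , _ , R-of) i α
  with R-of α
... | R , R-proper , M-α⊆R , _ with R-proper i
... | _ , _ , g , Tg , ¬Rg with IsSubgroup.inv (sT i) g Tg
... | g⁻¹ , Tg⁻¹ , gg⁻¹≡id =
  g⁻¹ , T⊆M i g⁻¹ Tg⁻¹ ,
  Ncomp-orbit-avoids M T dp i α (R i) (λ m m∈M-α → M-α⊆R m m∈M-α i) g g⁻¹ Tg ¬Rg gg⁻¹≡id
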